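{- Let $n\geq 600$ and let $G$ be a graph on $2n+1$ vertices with at least $n^2+n$ edges, such that $G$ contains no two vertices of the same degree joined by a path of length three, and $G$ is not $K_{n,n+1}$. Let $\Delta$ be the maximum degree of $G$ and let $\beta\geq 0$ be the largest integer such that $G$ contains two distinct vertices of degree $\beta$. Then $\beta\geq \Delta-1$ or $\Delta\leq n+1$.
   Context: Graphs are finite and simple. A path of length three is a path with three edges on four distinct vertices; its endpoints are said to be joined by it. -}

module Defs where

open import Data.Nat using (ℕ; zero; suc; _+_; _*_; _<_; _<ᵇ_)
open import Data.Bool using (Bool; true; false; if_then_else_; _xor_)
open import Data.Fin using (Fin; toℕ)
open import Data.List using (List; map)
open import Data.Nat.ListAction using (sum)
open import Data.List using () renaming (allFin to allFinL)
open import Data.Product using (Σ; _×_; _,_)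
open import Relation.Binary.PropositionalEquality using (_≡_; _≢_)
open import Relation.Nullary using (¬_)
open import Function.Bundles using (_↔_; Inverse)

record Graph (m : ℕ) : Set where
  field
    adj       : Fin m → Fin m → Bool
    symmetric : ∀ i j → adj i j ≡ adj j i
    irreflexive : ∀ i → adj i i ≡ false
open Graph public

𝟙 : Bool → ℕ
𝟙 b = if b then 1 else 0

degree : ∀ {m} → Graph m → Fin m → ℕ
degree {m} G v = sum (map (λ w → 𝟙 (adj G v w)) (allFinL m))

edgeCount : ∀ {m} → Graph m → ℕ
edgeCount {m} G =
  sum (map (λ i → sum (map (λ j → 𝟙 ((toℕ i <ᵇ toℕ j) Data.Bool.∧ adj G i j)) (allFinL m)))
           (allFinL m))

PathOfLength3 : ∀ {m} → Graph m → Fin m → Fin m → Set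
PathOfLength3 {m} G u v =
  Σ (Fin m) λ b → Σ (Fin m) λ c →
    (u ≢ b) × (u ≢ c) × (u ≢ v) × (b ≢ c) × (b ≢ v) × (c ≢ v) ×
    (adj G u b ≡ true) × (adj G b c ≡ true) × (adj G c v ≡ true)

NoEqualDegreeP3 : ∀ {m} → Graph m → Set
NoEqualDegreeP3 {m} G =
  ∀ (u v : Fin m) → degree G u ≡ degree G v → ¬ PathOfLength3 G u v

-- The complete bipartite graph K_{n,n+1} on Fin (2n+1):
-- parts {i | i < n} (size n) and {i | i ≥ n} (size n+1).
K : (n : ℕ) → Graph (n + suc n)
K n = record
  { adj = λ i j → (toℕ i <ᵇ n) xor (toℕ j <ᵇ n)
  ; symmetric = λ i j → xor-comm (toℕ i <ᵇ n) (toℕ j <ᵇ n)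
  ; irreflexive = λ i → xor-self (toℕ i <ᵇ n)
  }
  where
  xor-comm : ∀ a b → a xor b ≡ b xor a
  xor-comm false false = _≡_.refl
  xor-comm false true = _≡_.refl
  xor-comm true false = _≡_.refl
  xor-comm true true = _≡_.refl
  xor-self : ∀ a → a xor a ≡ false
  xor-self false = _≡_.refl
  xor-self true = _≡_.refl

_≅_ : ∀ {m} → Graph m → Graph m → Set
_≅_ {m} G H = Σ (Fin m ↔ Fin m) λ f →
  ∀ i j → adj G i j ≡ adj H (Inverse.to f i) (Inverse.to f j)

IsMaxDegree : ∀ {m} → Graph m → ℕ → Set
IsMaxDegree {m} G Δ = Σ (Fin m) (λ v → degree G v ≡ Δ) × (∀ v → degree G v Data.Nat.≤ Δ)

HasRepeatedDegree : ∀ {m} → Graph m → ℕ → Set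
HasRepeatedDegree {m} G b = Σ (Fin m) λ u → Σ (Fin m) λ v →
  (u ≢ v) × (degree G u ≡ b) × (degree G v ≡ b)

IsLargestRepeatedDegree : ∀ {m} → Graph m → ℕ → Set
IsLargestRepeatedDegree G β =
  HasRepeatedDegree G β × (∀ b → HasRepeatedDegree G b → b Data.Nat.≤ β)

-- Let x have the maximum degree Δ and let k = 2n + 1 − Δ count its non-neighbours, x
-- included. If β < Δ − 1, then x is the only vertex of degree Δ and at most one vertex
-- has degree Δ − 1. Two neighbours v, z of x of equal degree have degree at most k + 1:
-- a further neighbour w of v adjacent to x would give the path z x w v. Hence the
-- neighbours of x of degree above k + 1 have distinct degrees below Δ, and summing
-- degrees gives 2e(G) ≤ Δ(k + 1) + k(Δ − 2) + T(Δ − k − 2) + 3, with T(c) = 1 + ⋯ + c.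
-- For Δ ≥ n + 2 the right-hand side falls short of 2(n² + n) by exactly n − 4.
module Submission where

open import Defs
open import Data.Bool using (Bool; true; false; not; _∧_; if_then_else_; T)
open import Data.Empty using (⊥-elim)
open import Data.Fin using (Fin; zero; suc; toℕ)
import Data.Fin as Fin
import Data.Fin.Properties as Fin
open import Data.List using (map; allFin; tabulate)
open import Data.List.Properties using (map-tabulate)
open import Data.Nat
open import Data.Nat.ListAction using () renaming (sum to listSum)
open import Data.Nat.Properties
open import Data.Nat.Solver using (module +-*-Solver)
open import Data.Product using (_,_; _×_)
open import Data.Sum using (_⊎_; inj₁; inj₂)
open import Function using (_∘_; id)
open import Relation.Binary.PropositionalEquality
open import Relation.Binary.Definitions using (tri<; tri≈; tri>)
open import Relation.Nullary using (¬_; Dec; yes; no; does; contradiction)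
open import Relation.Unary using (Pred; Decidable)
open import Algebra.Properties.Semiring.Sum +-*-semiring
  using (sum-syntax; ∑-distrib-+; ∑-comm; sum-cong-≗; sum-replicate-zero; *-distribʳ-sum)

listSum-tabulate : ∀ {m} (f : Fin m → ℕ) → listSum (tabulate f) ≡ ∑[ i < m ] f i
listSum-tabulate {zero}  f = refl
listSum-tabulate {suc m} f = cong (f zero +_) (listSum-tabulate (f ∘ suc))

listSum-map-allFin : ∀ m (f : Fin m → ℕ) → listSum (map f (allFin m)) ≡ ∑[ i < m ] f i
listSum-map-allFin m f = trans (cong listSum (map-tabulate id f)) (listSum-tabulate f)

∑-mono-≤ : ∀ {m} {f g : Fin m → ℕ} → (∀ i → f i ≤ g i) →
           ∑[ i < m ] f i ≤ ∑[ i < m ] g i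
∑-mono-≤ {zero}  f≤g = z≤n
∑-mono-≤ {suc m} f≤g = +-mono-≤ (f≤g zero) (∑-mono-≤ (f≤g ∘ suc))

∑-const : ∀ m c → ∑[ i < m ] c ≡ m * c
∑-const zero    c = refl
∑-const (suc m) c = cong (c +_) (∑-const m c)

∑-count≤1 : ∀ {m p} {P : Pred (Fin m) p} (P? : Decidable P) →
            (∀ i j → P i → P j → i ≡ j) → ∑[ i < m ] 𝟙 (does (P? i)) ≤ 1
∑-count≤1 {zero}  P? unique = z≤n
∑-count≤1 {suc m} P? unique with P? zero
... | no _   = ∑-count≤1 (P? ∘ suc) (λ i j Pi Pj → Fin.suc-injective (unique _ _ Pi Pj))
... | yes P0 = ≤-reflexive (cong suc (trans (sum-cong-≗ nowhere-else) (sum-replicate-zero m)))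
  where
  nowhere-else : ∀ i → 𝟙 (does (P? (suc i))) ≡ 0
  nowhere-else i with P? (suc i)
  ... | no _   = refl
  ... | yes Pi with unique zero (suc i) P0 Pi
  ...   | ()

∑-𝟙[≟]≤1 : ∀ {m} (z : Fin m) → ∑[ w < m ] 𝟙 (does (w Fin.≟ z)) ≤ 1
∑-𝟙[≟]≤1 z = ∑-count≤1 (Fin._≟ z) (λ _ _ i≡z j≡z → trans i≡z (sym j≡z))

triangular : ℕ → ℕ
triangular zero    = 0
triangular (suc c) = suc c + triangular c

*2-triangular : ∀ c → triangular c * 2 ≡ c * suc c
*2-triangular zero    = refl
*2-triangular (suc c) = begin
  (suc c + triangular c) * 2    ≡⟨ *-distribʳ-+ 2 (suc c) (triangular c) ⟩
  suc c * 2 + triangular c * 2  ≡⟨ cong (suc c * 2 +_) (*2-triangular c) ⟩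
  suc c * 2 + c * suc c         ≡⟨ ring c ⟩
  suc c * suc (suc c)           ∎
  where
  open ≡-Reasoning
  open +-*-Solver
  ring : ∀ c → suc c * 2 + c * suc c ≡ suc c * suc (suc c)
  ring = solve 1 (λ c → (con 1 :+ c) :* con 2 :+ c :* (con 1 :+ c)
                     := (con 1 :+ c) :* (con 2 :+ c)) refl

triangular-odd : ∀ a → triangular (suc (a + a)) ≡ suc (a + a) * suc a
triangular-odd a = *-cancelʳ-≡ _ _ 2 (trans (*2-triangular (suc (a + a))) (ring a))
  where
  open +-*-Solver
  ring : ∀ a → suc (a + a) * suc (suc (a + a)) ≡ suc (a + a) * suc a * 2
  ring = solve 1 (λ a → (con 1 :+ (a :+ a)) :* (con 2 :+ (a :+ a))
                     := (con 1 :+ (a :+ a)) :* (con 1 :+ a) :* con 2) refl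

InjectiveOnPositives : ∀ {m} → (Fin m → ℕ) → Set
InjectiveOnPositives f = ∀ i j → 0 < f i → f i ≡ f j → i ≡ j

eraseIf : Bool → ℕ → ℕ
eraseIf b x = if b then 0 else x

eraseIf-pos : ∀ b x → 0 < eraseIf b x → eraseIf b x ≡ x
eraseIf-pos false x _ = refl

≤-eraseIf : ∀ {x c} (x≟c : Dec (x ≡ c)) → x ≤ eraseIf (does x≟c) x + 𝟙 (does x≟c) * c
≤-eraseIf {x} (yes refl) = m≤m+n x 0
≤-eraseIf {x} (no _)     = m≤m+n x 0

eraseIf-≤ : ∀ {x c} (x≟1+c : Dec (x ≡ suc c)) → x ≤ suc c → eraseIf (does x≟1+c) x ≤ c
eraseIf-≤ (yes _)    _     = z≤n
eraseIf-≤ (no x≢1+c) x≤1+c = ≤-pred (≤∧≢⇒< x≤1+c x≢1+c)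

∑-distinct≤triangular : ∀ {m} c (f : Fin m → ℕ) → (∀ i → f i ≤ c) →
                        InjectiveOnPositives f → ∑[ i < m ] f i ≤ triangular c
∑-distinct≤triangular {m} zero f f≤0 _ =
  ≤-trans (∑-mono-≤ f≤0) (≤-reflexive (sum-replicate-zero m))
∑-distinct≤triangular {m} (suc c) f f≤1+c f-inj = begin
  ∑[ i < m ] f i
    ≤⟨ ∑-mono-≤ (λ i → ≤-eraseIf (f i ≟ suc c)) ⟩
  ∑[ i < m ] (f′ i + top i * suc c)
    ≡⟨ ∑-distrib-+ f′ (λ i → top i * suc c) ⟩
  ∑[ i < m ] f′ i + ∑[ i < m ] (top i * suc c)
    ≡⟨ cong (∑[ i < m ] f′ i +_) (*-distribʳ-sum (suc c) top) ⟨
  ∑[ i < m ] f′ i + ∑[ i < m ] top i * suc c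
    ≤⟨ +-mono-≤ (∑-distinct≤triangular c f′ f′≤c f′-inj)
                (*-monoˡ-≤ (suc c) (∑-count≤1 (λ i → f i ≟ suc c) top-unique)) ⟩
  triangular c + 1 * suc c
    ≡⟨ +-comm (triangular c) (1 * suc c) ⟩
  1 * suc c + triangular c
    ≡⟨ cong (_+ triangular c) (*-identityˡ (suc c)) ⟩
  triangular (suc c) ∎
  where
  open ≤-Reasoning
  top : Fin m → ℕ
  top i = 𝟙 (does (f i ≟ suc c))
  f′ : Fin m → ℕ
  f′ i = eraseIf (does (f i ≟ suc c)) (f i)
  f′≤c : ∀ i → f′ i ≤ c
  f′≤c i = eraseIf-≤ (f i ≟ suc c) (f≤1+c i)
  f′-inj : InjectiveOnPositives f′
  f′-inj i j pos eq = f-inj i j (subst (0 <_) f′i≡fi pos)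
    (trans (sym f′i≡fi) (trans eq (eraseIf-pos _ (f j) (subst (0 <_) eq pos))))
    where f′i≡fi = eraseIf-pos _ (f i) pos
  top-unique : ∀ i j → f i ≡ suc c → f j ≡ suc c → i ≡ j
  top-unique i j fi fj = f-inj i j (subst (0 <_) (sym fi) z<s) (trans fi (sym fj))

0<m∸n⇒n<m : ∀ m n → 0 < m ∸ n → n < m
0<m∸n⇒n<m (suc m) zero    _   = z<s
0<m∸n⇒n<m (suc m) (suc n) pos = s<s (0<m∸n⇒n<m m n pos)

<ᵇ≡true⇒< : ∀ {m n} → (m <ᵇ n) ≡ true → m < n
<ᵇ≡true⇒< {m} {n} m<ᵇn = <ᵇ⇒< m n (subst T (sym m<ᵇn) _)

𝟙+𝟙-not : ∀ b → 𝟙 b + 𝟙 (not b) ≡ 1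
𝟙+𝟙-not true  = refl
𝟙+𝟙-not false = refl

if≡𝟙* : ∀ b (p q : ℕ) → (if b then p else q) ≡ 𝟙 b * p + 𝟙 (not b) * q
if≡𝟙* true  p q = sym (trans (+-identityʳ (p + 0)) (+-identityʳ p))
if≡𝟙* false p q = sym (+-identityʳ q)

module _ {m} (G : Graph m) where

  degree≡∑ : ∀ v → degree G v ≡ ∑[ w < m ] 𝟙 (adj G v w)
  degree≡∑ v = listSum-map-allFin m _

  upperEdge : Fin m → Fin m → ℕ
  upperEdge i j = 𝟙 ((toℕ i <ᵇ toℕ j) ∧ adj G i j)

  edgeCount≡∑ : edgeCount G ≡ ∑[ i < m ] ∑[ j < m ] upperEdge i j
  edgeCount≡∑ = trans (listSum-map-allFin m _)
                      (sum-cong-≗ (λ i → listSum-map-allFin m (upperEdge i)))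

  𝟙adj≡upperEdge+upperEdge : ∀ i j → 𝟙 (adj G i j) ≡ upperEdge i j + upperEdge j i
  𝟙adj≡upperEdge+upperEdge i j with toℕ i <ᵇ toℕ j in i<j | toℕ j <ᵇ toℕ i in j<i
  ... | true  | true  = ⊥-elim (<-asym (<ᵇ≡true⇒< {toℕ i} i<j) (<ᵇ≡true⇒< {toℕ j} j<i))
  ... | true  | false = sym (+-identityʳ _)
  ... | false | true  = cong 𝟙 (symmetric G i j)
  ... | false | false with <-cmp (toℕ i) (toℕ j)
  ...   | tri< i<j′ _ _ = ⊥-elim (subst T i<j (<⇒<ᵇ i<j′))
  ...   | tri> _ _ j<i′ = ⊥-elim (subst T j<i (<⇒<ᵇ j<i′))
  ...   | tri≈ _ i≡j _ rewrite Fin.toℕ-injective i≡j = cong 𝟙 (irreflexive G j)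

  handshake : ∑[ v < m ] degree G v ≡ edgeCount G + edgeCount G
  handshake = begin
    ∑[ i < m ] degree G i
      ≡⟨ sum-cong-≗ (λ i → trans (degree≡∑ i) (sum-cong-≗ (𝟙adj≡upperEdge+upperEdge i))) ⟩
    ∑[ i < m ] ∑[ j < m ] (upperEdge i j + upperEdge j i)
      ≡⟨ sum-cong-≗ (λ i → ∑-distrib-+ (upperEdge i) (λ j → upperEdge j i)) ⟩
    ∑[ i < m ] (∑[ j < m ] upperEdge i j + ∑[ j < m ] upperEdge j i)
      ≡⟨ ∑-distrib-+ (λ i → ∑[ j < m ] upperEdge i j) (λ i → ∑[ j < m ] upperEdge j i) ⟩
    ∑[ i < m ] ∑[ j < m ] upperEdge i j + ∑[ i < m ] ∑[ j < m ] upperEdge j i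
      ≡⟨ cong (∑[ i < m ] ∑[ j < m ] upperEdge i j +_) (∑-comm (λ i j → upperEdge j i)) ⟩
    ∑[ i < m ] ∑[ j < m ] upperEdge i j + ∑[ i < m ] ∑[ j < m ] upperEdge i j
      ≡⟨ cong₂ _+_ edgeCount≡∑ edgeCount≡∑ ⟨
    edgeCount G + edgeCount G ∎
    where open ≡-Reasoning

  adj⇒≢ : ∀ {u v} → adj G u v ≡ true → u ≢ v
  adj⇒≢ {u} uv refl = contradiction (trans (sym uv) (irreflexive G u)) (λ ())

  -- Counts x itself, since adj G x x ≡ false.
  nonNeighbours : Fin m → ℕ
  nonNeighbours x = ∑[ w < m ] 𝟙 (not (adj G x w))

  degree+nonNeighbours : ∀ x → degree G x + nonNeighbours x ≡ m
  degree+nonNeighbours x = begin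
    degree G x + nonNeighbours x
      ≡⟨ cong (_+ nonNeighbours x) (degree≡∑ x) ⟩
    ∑[ w < m ] 𝟙 (adj G x w) + nonNeighbours x
      ≡⟨ ∑-distrib-+ (𝟙 ∘ adj G x) (𝟙 ∘ not ∘ adj G x) ⟨
    ∑[ w < m ] (𝟙 (adj G x w) + 𝟙 (not (adj G x w)))
      ≡⟨ sum-cong-≗ (𝟙+𝟙-not ∘ adj G x) ⟩
    ∑[ w < m ] 1
      ≡⟨ ∑-const m 1 ⟩
    m * 1
      ≡⟨ *-identityʳ m ⟩
    m ∎
    where open ≡-Reasoning

  equalDegreeNeighbours-degree≤ : NoEqualDegreeP3 G → ∀ {x v z} →
    adj G x v ≡ true → adj G x z ≡ true → z ≢ v → degree G z ≡ degree G v →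
    degree G v ≤ suc (nonNeighbours x)
  equalDegreeNeighbours-degree≤ noP3 {x} {v} {z} xv xz z≢v dz≡dv = begin
    degree G v
      ≡⟨ degree≡∑ v ⟩
    ∑[ w < m ] 𝟙 (adj G v w)
      ≤⟨ ∑-mono-≤ (λ w → neighbour-of-v w (w Fin.≟ z)) ⟩
    ∑[ w < m ] (is-z w + 𝟙 (not (adj G x w)))
      ≡⟨ ∑-distrib-+ is-z (𝟙 ∘ not ∘ adj G x) ⟩
    ∑[ w < m ] is-z w + nonNeighbours x
      ≤⟨ +-monoˡ-≤ (nonNeighbours x) (∑-𝟙[≟]≤1 z) ⟩
    suc (nonNeighbours x) ∎
    where
    open ≤-Reasoning
    is-z : Fin m → ℕ
    is-z w = 𝟙 (does (w Fin.≟ z))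
    -- A neighbour w ≠ z of v that is adjacent to x would close the path z x w v.
    neighbour-of-v : ∀ w (w≟z : Dec (w ≡ z)) →
                     𝟙 (adj G v w) ≤ 𝟙 (does w≟z) + 𝟙 (not (adj G x w))
    neighbour-of-v w w≟z with adj G v w in vw
    ... | false = z≤n
    ... | true with w≟z
    ...   | yes _  = s≤s z≤n
    ...   | no w≢z with adj G x w in xw
    ...     | false = s≤s z≤n
    ...     | true  = ⊥-elim (noP3 z v dz≡dv
                (x , w , adj⇒≢ zx , w≢z ∘ sym , z≢v , adj⇒≢ xw , adj⇒≢ xv , adj⇒≢ wv ,
                 zx , xw , wv))
      where
      zx : adj G z x ≡ true
      zx = trans (symmetric G z x) xz
      wv : adj G w v ≡ true
      wv = trans (symmetric G w v) vw

module _ {m} (G : Graph m) (noP3 : NoEqualDegreeP3 G) {x : Fin m} {Δ : ℕ}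
         (degree-x : degree G x ≡ Δ)
         (others-≤ : ∀ v → v ≢ x → degree G v ≤ Δ ∸ 1)
         (Δ∸1-once : ∀ u v → degree G u ≡ Δ ∸ 1 → degree G v ≡ Δ ∸ 1 → u ≡ v) where

  private
    d = degree G
    k = nonNeighbours G x

  base : Fin m → ℕ
  base v = if adj G x v then suc k else Δ ∸ 2

  excess : Fin m → ℕ
  excess v = if adj G x v then d v ∸ suc k else 0

  correction : Fin m → ℕ
  correction v = 𝟙 (does (v Fin.≟ x)) * 2 + 𝟙 (does (d v ≟ Δ ∸ 1))

  degree≤base+excess+correction : ∀ v → d v ≤ base v + excess v + correction v
  degree≤base+excess+correction v = bound (v Fin.≟ x) (d v ≟ Δ ∸ 1)
    where
    bound : (v≟x : Dec (v ≡ x)) (dv≟Δ∸1 : Dec (d v ≡ Δ ∸ 1)) →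
            d v ≤ base v + excess v + (𝟙 (does v≟x) * 2 + 𝟙 (does dv≟Δ∸1))
    bound v≟x dv≟Δ∸1 with adj G x v
    ... | true = ≤-trans (m≤n+m∸n (d v) (suc k)) (m≤m+n _ _)
    bound (yes refl) _ | false = begin
      d x                   ≡⟨ degree-x ⟩
      Δ                     ≤⟨ m≤n+m∸n Δ 2 ⟩
      2 + (Δ ∸ 2)           ≡⟨ +-comm 2 (Δ ∸ 2) ⟩
      Δ ∸ 2 + 2             ≤⟨ +-mono-≤ (m≤m+n (Δ ∸ 2) 0) (m≤m+n 2 _) ⟩
      Δ ∸ 2 + 0 + (2 + _)   ∎
      where open ≤-Reasoning
    bound (no _) (yes dv≡Δ∸1) | false = begin
      d v                   ≡⟨ dv≡Δ∸1 ⟩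
      Δ ∸ 1                 ≤⟨ m≤n+m∸n (Δ ∸ 1) 1 ⟩
      1 + (Δ ∸ 1 ∸ 1)       ≡⟨ +-comm 1 _ ⟩
      Δ ∸ 1 ∸ 1 + 1         ≡⟨ cong (_+ 1) (∸-+-assoc Δ 1 1) ⟩
      Δ ∸ 2 + 1             ≡⟨ cong (_+ 1) (+-identityʳ (Δ ∸ 2)) ⟨
      Δ ∸ 2 + 0 + 1         ∎
      where open ≤-Reasoning
    bound (no v≢x) (no dv≢Δ∸1) | false = begin
      d v                   ≤⟨ <⇒≤pred (≤∧≢⇒< (others-≤ v v≢x) dv≢Δ∸1) ⟩
      pred (Δ ∸ 1)          ≡⟨ pred[m∸n]≡m∸[1+n] Δ 1 ⟩
      Δ ∸ 2                 ≤⟨ m≤m+n (Δ ∸ 2) 0 ⟩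
      Δ ∸ 2 + 0             ≤⟨ m≤m+n (Δ ∸ 2 + 0) 0 ⟩
      Δ ∸ 2 + 0 + 0         ∎
      where open ≤-Reasoning

  excess-≤ : ∀ v → excess v ≤ Δ ∸ 1 ∸ suc k
  excess-≤ v with adj G x v in xv
  ... | true  = ∸-monoˡ-≤ (suc k) (others-≤ v (adj⇒≢ G xv ∘ sym))
  ... | false = z≤n

  excess-pos⇒neighbour : ∀ v → 0 < excess v →
                         adj G x v ≡ true × excess v ≡ d v ∸ suc k × suc k < d v
  excess-pos⇒neighbour v pos with adj G x v
  ... | true = refl , refl , 0<m∸n⇒n<m (d v) (suc k) pos

  excess-injective : InjectiveOnPositives excess
  excess-injective i j pos eq
    with excess-pos⇒neighbour i pos | excess-pos⇒neighbour j (subst (0 <_) eq pos)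
  ... | xi , ei , k<di | xj , ej , k<dj with i Fin.≟ j
  ...   | yes i≡j = i≡j
  ...   | no  i≢j = contradiction
          (equalDegreeNeighbours-degree≤ G noP3 xi xj (i≢j ∘ sym) (sym di≡dj)) (<⇒≱ k<di)
    where
    di≡dj : d i ≡ d j
    di≡dj = ∸-cancelʳ-≡ (<⇒≤ k<di) (<⇒≤ k<dj) (trans (sym ei) (trans eq ej))

  ∑base : ∑[ v < m ] base v ≡ Δ * suc k + k * (Δ ∸ 2)
  ∑base = begin
    ∑[ v < m ] base v
      ≡⟨ sum-cong-≗ (λ v → if≡𝟙* (adj G x v) (suc k) (Δ ∸ 2)) ⟩
    ∑[ v < m ] (𝟙 (adj G x v) * suc k + 𝟙 (not (adj G x v)) * (Δ ∸ 2))
      ≡⟨ ∑-distrib-+ (λ v → 𝟙 (adj G x v) * suc k) (λ v → 𝟙 (not (adj G x v)) * (Δ ∸ 2)) ⟩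
    ∑[ v < m ] (𝟙 (adj G x v) * suc k) + ∑[ v < m ] (𝟙 (not (adj G x v)) * (Δ ∸ 2))
      ≡⟨ cong₂ _+_ (*-distribʳ-sum (suc k) (𝟙 ∘ adj G x))
                   (*-distribʳ-sum (Δ ∸ 2) (𝟙 ∘ not ∘ adj G x)) ⟨
    ∑[ v < m ] 𝟙 (adj G x v) * suc k + k * (Δ ∸ 2)
      ≡⟨ cong (λ δ → δ * suc k + k * (Δ ∸ 2)) (trans (sym (degree≡∑ G x)) degree-x) ⟩
    Δ * suc k + k * (Δ ∸ 2) ∎
    where open ≡-Reasoning

  ∑correction≤3 : ∑[ v < m ] correction v ≤ 3
  ∑correction≤3 = begin
    ∑[ v < m ] correction v
      ≡⟨ ∑-distrib-+ (λ v → is-x v * 2) has-Δ∸1 ⟩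
    ∑[ v < m ] (is-x v * 2) + ∑[ v < m ] has-Δ∸1 v
      ≡⟨ cong (_+ ∑[ v < m ] has-Δ∸1 v) (*-distribʳ-sum 2 is-x) ⟨
    ∑[ v < m ] is-x v * 2 + ∑[ v < m ] has-Δ∸1 v
      ≤⟨ +-mono-≤ (*-monoˡ-≤ 2 (∑-𝟙[≟]≤1 x))
                  (∑-count≤1 (λ v → d v ≟ Δ ∸ 1) Δ∸1-once) ⟩
    3 ∎
    where
    open ≤-Reasoning
    is-x has-Δ∸1 : Fin m → ℕ
    is-x v = 𝟙 (does (v Fin.≟ x))
    has-Δ∸1 v = 𝟙 (does (d v ≟ Δ ∸ 1))

  twiceEdgeCount≤ : edgeCount G + edgeCount G ≤
                    Δ * suc k + k * (Δ ∸ 2) + triangular (Δ ∸ 1 ∸ suc k) + 3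
  twiceEdgeCount≤ = begin
    edgeCount G + edgeCount G
      ≡⟨ handshake G ⟨
    ∑[ v < m ] d v
      ≤⟨ ∑-mono-≤ degree≤base+excess+correction ⟩
    ∑[ v < m ] (base v + excess v + correction v)
      ≡⟨ ∑-distrib-+ (λ v → base v + excess v) correction ⟩
    ∑[ v < m ] (base v + excess v) + ∑[ v < m ] correction v
      ≡⟨ cong (_+ ∑[ v < m ] correction v) (∑-distrib-+ base excess) ⟩
    ∑[ v < m ] base v + ∑[ v < m ] excess v + ∑[ v < m ] correction v
      ≤⟨ +-mono-≤ (+-mono-≤ (≤-reflexive ∑base)
                            (∑-distinct≤triangular _ excess excess-≤ excess-injective))
                  ∑correction≤3 ⟩
    Δ * suc k + k * (Δ ∸ 2) + triangular (Δ ∸ 1 ∸ suc k) + 3 ∎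
    where open ≤-Reasoning

edgeBound-gap : ∀ k a → let n = suc k + a ; Δ = 3 + (k + (a + a)) in
  Δ * suc k + k * (Δ ∸ 2) + triangular (Δ ∸ 1 ∸ suc k) + (a + k) ≡ (n * n + n) + (n * n + n)
edgeBound-gap k a = begin
  A + triangular (Δ ∸ 1 ∸ suc k) + (a + k)   ≡⟨ cong (λ c → A + triangular c + (a + k)) Δ∸1∸[1+k] ⟩
  A + triangular (suc (a + a)) + (a + k)     ≡⟨ cong (λ t → A + t + (a + k)) (triangular-odd a) ⟩
  A + suc (a + a) * suc a + (a + k)          ≡⟨ ring k a ⟩
  (n * n + n) + (n * n + n)                  ∎
  where
  open ≡-Reasoning
  open +-*-Solver
  n = suc k + a
  Δ = 3 + (k + (a + a))
  A = Δ * suc k + k * (Δ ∸ 2)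
  Δ∸1∸[1+k] : Δ ∸ 1 ∸ suc k ≡ suc (a + a)
  Δ∸1∸[1+k] = trans (cong (_∸ k) (sym (+-suc k (a + a)))) (m+n∸m≡n k (suc (a + a)))
  ring : ∀ k a → let n = suc k + a in
    (3 + (k + (a + a))) * suc k + k * suc (k + (a + a)) + suc (a + a) * suc a + (a + k)
      ≡ (n * n + n) + (n * n + n)
  ring = solve 2 (λ k a → (con 3 :+ (k :+ (a :+ a))) :* (con 1 :+ k) :+ k :* (con 1 :+ (k :+ (a :+ a)))
                          :+ (con 1 :+ (a :+ a)) :* (con 1 :+ a) :+ (a :+ k)
                        := ((con 1 :+ k :+ a) :* (con 1 :+ k :+ a) :+ (con 1 :+ k :+ a))
                           :+ ((con 1 :+ k :+ a) :* (con 1 :+ k :+ a) :+ (con 1 :+ k :+ a))) refl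

edgeBound<2[n²+n] : ∀ {n k Δ} → 5 ≤ n → Δ + k ≡ n + suc n → suc (suc n) ≤ Δ →
  Δ * suc k + k * (Δ ∸ 2) + triangular (Δ ∸ 1 ∸ suc k) + 3 < (n * n + n) + (n * n + n)
edgeBound<2[n²+n] {n} {k} {Δ} 5≤n Δ+k≡2n+1 n+2≤Δ with m≤n⇒∃[o]m+o≡n k<n
  where
  open +-*-Solver
  k<n : k < n
  k<n = ≤-pred (+-cancelˡ-≤ n (suc (suc k)) (suc n) (begin
    n + suc (suc k)    ≡⟨ solve 2 (λ n k → n :+ (con 2 :+ k) := (con 2 :+ n) :+ k) refl n k ⟩
    suc (suc n) + k    ≤⟨ +-monoˡ-≤ k n+2≤Δ ⟩
    Δ + k              ≡⟨ Δ+k≡2n+1 ⟩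
    n + suc n          ∎))
    where open ≤-Reasoning
... | a , refl with +-cancelʳ-≡ k Δ (3 + (k + (a + a))) (trans Δ+k≡2n+1 (ring k a))
  where
  open +-*-Solver
  ring : ∀ k a → suc k + a + suc (suc k + a) ≡ 3 + (k + (a + a)) + k
  ring = solve 2 (λ k a → (con 1 :+ k :+ a) :+ (con 1 :+ (con 1 :+ k :+ a))
                       := con 3 :+ (k :+ (a :+ a)) :+ k) refl
... | refl = begin-strict
  B + 3            <⟨ +-monoʳ-< B (subst (3 <_) (+-comm k a) (≤-pred 5≤n)) ⟩
  B + (a + k)      ≡⟨ edgeBound-gap k a ⟩
  (n * n + n) + (n * n + n) ∎
  where
  open ≤-Reasoning
  B = Δ * suc k + k * (Δ ∸ 2) + triangular (Δ ∸ 1 ∸ suc k)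

lemma2p2 : (n : ℕ) → 600 ≤ n → (G : Graph (n + suc n)) →
    n * n + n ≤ edgeCount G →
    NoEqualDegreeP3 G →
    ¬ (G ≅ K n) →
    (Δ β : ℕ) → IsMaxDegree G Δ → IsLargestRepeatedDegree G β →
    (Δ ∸ 1 ≤ β) ⊎ (Δ ≤ suc n)
lemma2p2 n 600≤n G n²+n≤e noP3 _ Δ β ((x , degree-x) , maximal) (_ , largest)
  with Δ ∸ 1 ≤? β | Δ ≤? suc n
... | yes Δ∸1≤β | _         = inj₁ Δ∸1≤β
... | no  _     | yes Δ≤n+1 = inj₂ Δ≤n+1
... | no  Δ∸1≰β | no  Δ≰n+1 = ⊥-elim (<⇒≱
      (edgeBound<2[n²+n] (≤-trans (m≤m+n 5 595) 600≤n)
                         (trans (cong (_+ _) (sym degree-x)) (degree+nonNeighbours G x))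
                         (≰⇒> Δ≰n+1))
      (≤-trans (+-mono-≤ n²+n≤e n²+n≤e) (twiceEdgeCount≤ G noP3 degree-x others-≤ Δ∸1-once)))
  where
  others-≤ : ∀ v → v ≢ x → degree G v ≤ Δ ∸ 1
  others-≤ v v≢x = <⇒≤pred (≤∧≢⇒< (maximal v) λ dv≡Δ →
    Δ∸1≰β (≤-trans (m∸n≤m Δ 1) (largest Δ (v , x , v≢x , dv≡Δ , degree-x))))
  Δ∸1-once : ∀ u v → degree G u ≡ Δ ∸ 1 → degree G v ≡ Δ ∸ 1 → u ≡ v
  Δ∸1-once u v du dv with u Fin.≟ v
  ... | yes u≡v = u≡v
  ... | no  u≢v = contradiction (largest (Δ ∸ 1) (u , v , u≢v , du , dv)) Δ∸1≰β
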